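{- Let $\mathrm{H}$ be a retract-trivial reflexive digraph with at least three vertices. Then (1) $\mathrm{H}$ has no double edge; (2) $\mathrm{H}$ is strongly connected; and (3) every automorphism of $\mathrm{H}$ is an isolated vertex of the endomorphism digraph $\widehat{\mathrm{H}^{\mathrm{H}}}$.
   Context: Digraphs are finite and may have loops; reflexive means every vertex has a loop. A double edge is a pair of distinct vertices $u,v$ with both $(u,v)$ and $(v,u)$ edges. A digraph is strongly connected if for all vertices $u,v$ there is a directed path from $u$ to $v$. An endomorphism of $\mathrm{H}$ is a map $f:V(\mathrm{H})\to V(\mathrm{H})$ sending edges to edges; an automorphism is a bijective endomorphism whose inverse is a homomorphism. A retraction is an endomorphism $r$ that is the identity on its image; $\mathrm{H}$ is retract-trivial if its only retractions are the identity and constant maps. The endomorphism digraph $\widehat{\mathrm{H}^{\mathrm{H}}}$ has as vertices the endomorphisms of $\mathrm{H}$, with an edge $(f,g)$ iff $(f(x),g(y))\in E(\mathrm{H})$ for every $(x,y)\in E(\mathrm{H})$. A vertex is isolated if it has no edge to or from any other vertex (loops are allowed). -}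

module Defs where

open import Data.Nat using (ℕ)
open import Data.Fin using (Fin)
open import Data.Product using (Σ; ∃; _×_)
open import Data.Sum using (_⊎_)
open import Relation.Nullary using (¬_)
open import Relation.Binary using (Decidable)
open import Relation.Binary.PropositionalEquality using (_≡_; _≢_)
open import Level using (0ℓ; suc)

record Digraph : Set₁ where
  field
    n    : ℕ
    E    : Fin n → Fin n → Set
    E?   : Decidable E

open Digraph public

module _ (H : Digraph) where
  V : Set
  V = Fin (n H)

  Reflexive : Set
  Reflexive = ∀ x → E H x x

  IsHom : (V → V) → Set
  IsHom f = ∀ x y → E H x y → E H (f x) (f y)

  IsEndo : (V → V) → Set
  IsEndo = IsHom

  IsAutomorphism : (V → V) → Set
  IsAutomorphism f = IsHom f × Σ (V → V) (λ g →
    (∀ x → g (f x) ≡ x) × (∀ y → f (g y) ≡ y) × IsHom g)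

  IsRetraction : (V → V) → Set
  IsRetraction r = IsEndo r × (∀ x → r (r x) ≡ r x)

  IsConstant : (V → V) → Set
  IsConstant r = ∃ λ c → ∀ x → r x ≡ c

  RetractTrivial : Set
  RetractTrivial = ∀ r → IsRetraction r → (∀ x → r x ≡ x) ⊎ IsConstant r

  HasDoubleEdge : Set
  HasDoubleEdge = ∃ λ u → ∃ λ v → u ≢ v × E H u v × E H v u

  data Path : V → V → Set where
    here  : ∀ {u} → Path u u
    step  : ∀ {u v w} → E H u v → Path v w → Path u w

  StronglyConnected : Set
  StronglyConnected = ∀ u v → Path u v

  EndoEdge : (V → V) → (V → V) → Set
  EndoEdge f g = ∀ x y → E H x y → E H (f x) (g y)

  IsolatedInEndoDigraph : (V → V) → Set
  IsolatedInEndoDigraph f = ∀ g → IsEndo g → ¬ (∀ x → f x ≡ g x) →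
    ¬ EndoEdge f g × ¬ EndoEdge g f

-- Collapsing a decidable
-- set onto one of its vertices and its complement onto an outside vertex is never a
-- homomorphism, since the result would be neither the identity (there is a third vertex)
-- nor constant; a double edge, or a proper out-closed set of vertices, would make such a
-- collapse a homomorphism. And the idempotent power e of an endomorphism k with an edge
-- from id to k in the endomorphism digraph is the identity or constant: if e = id, then x
-- and k x span a double edge unless k x = x; if e is constant with value c, every vertex
-- has an edge into c, so c has no out-edge to another vertex, contradicting strong
-- connectivity. An edge between an automorphism f and g reduces to this case for
-- k = f⁻¹ ∘ g, in H or in its reverse.
module Submission where

open import Defs
open import Data.Bool using (if_then_else_)
open import Data.Empty using (⊥; ⊥-elim)
open import Data.Fin using (Fin; toℕ; zero; suc; _≟_)
open import Data.Fin.Properties using (any?; pigeonhole; toℕ≤pred[n])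
open import Data.Fin.Subset using (Subset; _∈_; _∉_; ⁅_⁆; _∪_; ∣_∣; _⊆_)
open import Data.Fin.Subset.Properties
  using (_∈?_; x∈⁅x⁆; x∈⁅y⁆⇒x≡y; x∈p∪q⁻; x∈p∪q⁺; p⊂q⇒∣p∣<∣q∣; ∣p∣≤n)
open import Data.Nat using (ℕ; zero; suc; pred; _+_; _*_; _≤_; _<_; _!; s≤s; z≤n)
open import Data.Nat.Divisibility using (divides; ∣-trans; m∣m*n; m≤n⇒m!∣n!)
open import Data.Nat.GeneralisedArithmetic using (iterate)
open import Data.Nat.Properties
  using (+-assoc; +-comm; +-suc; +-identityʳ; n<1+n; ≤-trans; ≤-reflexive; m≤n+m; +-monoˡ-≤;
         <-≤-trans; <⇒≱; *-identityʳ; *-monoʳ-≤; 1≤n!; m≤n⇒∃[o]m+o≡n)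
open import Data.Product using (∃; ∃₂; _×_; _,_)
open import Data.Sum using (inj₁; inj₂)
open import Function using (id; _∘_)
open import Relation.Nullary using (¬_; yes; no; does)
open import Relation.Nullary.Decidable using (dec-true; dec-false; decidable-stable; ¬?; _×-dec_)
open import Level using (0ℓ)
open import Relation.Unary using (Pred; Decidable)
open import Relation.Binary.PropositionalEquality
  using (_≡_; _≢_; refl; sym; trans; cong; subst; module ≡-Reasoning)

avoid₂ : ∀ {N} → 3 ≤ N → (a b : Fin N) → ∃ λ w → w ≢ a × w ≢ b
avoid₂ (s≤s (s≤s (s≤s _))) a b with zero ≟ a | zero ≟ b
... | no 0≢a | no 0≢b = zero , 0≢a , 0≢b
... | yes refl | _ with suc zero ≟ b
...   | no 1≢b   = suc zero , (λ ()) , 1≢b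
...   | yes refl = suc (suc zero) , (λ ()) , (λ ())
avoid₂ (s≤s (s≤s (s≤s _))) a b | no _ | yes refl with suc zero ≟ a
...   | no 1≢a   = suc zero , 1≢a , (λ ())
...   | yes refl = suc (suc zero) , (λ ()) , (λ ())

n≤n! : ∀ n → n ≤ n !
n≤n! zero    = z≤n
n≤n! (suc n) = ≤-trans (≤-reflexive (sym (*-identityʳ (suc n)))) (*-monoʳ-≤ (suc n) (1≤n! n))

module _ {A : Set} (f : A → A) where

  iterate-+ : ∀ x m n → iterate f x (m + n) ≡ iterate f (iterate f x m) n
  iterate-+ x zero    n = refl
  iterate-+ x (suc m) n = iterate-+ (f x) m n

  iterate-pred : ∀ {x m} → 1 ≤ m → iterate f x m ≡ iterate f (f x) (pred m)
  iterate-pred {m = suc m} _ = refl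

  iterate-periodic : ∀ {x a d} → iterate f x (a + d) ≡ iterate f x a →
                     ∀ q m → a ≤ m → iterate f x (q * d + m) ≡ iterate f x m
  iterate-periodic cycle zero m a≤m = refl
  iterate-periodic {x} {a} {d} cycle (suc q) m a≤m = begin
    iterate f x ((d + q * d) + m) ≡⟨ cong (iterate f x) (+-assoc d (q * d) m) ⟩
    iterate f x (d + (q * d + m)) ≡⟨ shift (≤-trans a≤m (m≤n+m m (q * d))) ⟩
    iterate f x (q * d + m)       ≡⟨ iterate-periodic cycle q m a≤m ⟩
    iterate f x m                 ∎
    where
    open ≡-Reasoning
    shift : ∀ {m} → a ≤ m → iterate f x (d + m) ≡ iterate f x m
    shift a≤m with t , refl ← m≤n⇒∃[o]m+o≡n a≤m = begin
      iterate f x (d + (a + t))         ≡⟨ cong (iterate f x) (sym (+-assoc d a t)) ⟩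
      iterate f x ((d + a) + t)         ≡⟨ cong (λ s → iterate f x (s + t)) (+-comm d a) ⟩
      iterate f x ((a + d) + t)         ≡⟨ iterate-+ x (a + d) t ⟩
      iterate f (iterate f x (a + d)) t ≡⟨ cong (λ y → iterate f y t) cycle ⟩
      iterate f (iterate f x a) t       ≡⟨ sym (iterate-+ x a t) ⟩
      iterate f x (a + t)               ∎

module _ {N : ℕ} (f : Fin N → Fin N) where

  orbit-cycle : ∀ x → ∃₂ λ a d → a ≤ N × suc d ≤ N × iterate f x (a + suc d) ≡ iterate f x a
  orbit-cycle x with i , j , i<j , fⁱx≡fʲx ← pigeonhole (n<1+n N) (iterate f x ∘ toℕ)
                with d , i+1+d≡j ← m≤n⇒∃[o]m+o≡n i<j =
    toℕ i , d , toℕ≤pred[n] i ,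
    ≤-trans (≤-trans (m≤n+m (suc d) (toℕ i)) (≤-reflexive i+d+1≡j)) (toℕ≤pred[n] j) ,
    trans (cong (iterate f x) i+d+1≡j) (sym fⁱx≡fʲx)
    where
    i+d+1≡j : toℕ i + suc d ≡ toℕ j
    i+d+1≡j = trans (+-suc (toℕ i) d) i+1+d≡j

  -- Every orbit is eventually periodic with period at most N, and such periods divide N!.
  iterate-!-idempotent : ∀ x → iterate f (iterate f x (N !)) (N !) ≡ iterate f x (N !)
  iterate-!-idempotent x with a , d , a≤N , d<N , cycle ← orbit-cycle x
                         with divides q N!≡q*d ← ∣-trans (m∣m*n (d !)) (m≤n⇒m!∣n! d<N) = begin
    iterate f (iterate f x (N !)) (N !) ≡⟨ sym (iterate-+ f x (N !) (N !)) ⟩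
    iterate f x (N ! + N !)             ≡⟨ cong (λ s → iterate f x (s + N !)) N!≡q*d ⟩
    iterate f x (q * suc d + N !)       ≡⟨ iterate-periodic f cycle q (N !) (≤-trans a≤N (n≤n! N)) ⟩
    iterate f x (N !)                   ∎
    where open ≡-Reasoning

op : Digraph → Digraph
op H = record { n = n H ; E = λ x y → E H y x ; E? = λ x y → E? H y x }

module _ (H : Digraph) where

  iterate-isHom : ∀ {f} → IsHom H f → ∀ m → IsHom H (λ x → iterate f x m)
  iterate-isHom f-hom zero    x y e = e
  iterate-isHom f-hom (suc m) x y e = iterate-isHom f-hom m _ _ (f-hom x y e)

  iterate-endoEdge-id : ∀ {f} → EndoEdge H id f → ∀ m → EndoEdge H id (λ x → iterate f x m)
  iterate-endoEdge-id id⟶f zero    x y e = e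
  iterate-endoEdge-id id⟶f (suc m) x y e = iterate-endoEdge-id id⟶f m x _ (id⟶f x y e)

  sink-reaches-only-itself : ∀ {c w} → (∀ {v} → E H c v → v ≡ c) → Path H c w → w ≡ c
  sink-reaches-only-itself out here       = refl
  sink-reaches-only-itself out (step e p) with refl ← out e = sink-reaches-only-itself out p

  OutClosed : Subset (n H) → Set
  OutClosed p = ∀ {x y} → x ∈ p → E H x y → y ∈ p

  ReachableFrom : V H → Subset (n H) → Set
  ReachableFrom u p = ∀ x → x ∈ p → Path H u x

  snoc : ∀ {u x y} → Path H u x → E H x y → Path H u y
  snoc here       e = step e here
  snoc (step e p) f = step e (snoc p f)

  -- The fuel k bounds the number of vertices that can still be added to p.
  out-closure : ∀ {u} k p → n H < ∣ p ∣ + k → ReachableFrom u p →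
                ∃ λ q → p ⊆ q × OutClosed q × ReachableFrom u q
  out-closure {u} k p fuel reach
    with any? (λ x → any? (λ y → x ∈? p ×-dec (E? H x y ×-dec ¬? (y ∈? p))))
  ... | no none = p , id , closed , reach
    where
    closed : OutClosed p
    closed {x} {y} x∈p e = decidable-stable (y ∈? p) (λ y∉p → none (x , y , x∈p , e , y∉p))
  ... | yes (x , y , x∈p , e , y∉p) with k
  ...   | zero   = ⊥-elim (<⇒≱ fuel (≤-trans (≤-reflexive (+-identityʳ ∣ p ∣)) (∣p∣≤n p)))
  ...   | suc k′ =
    let q , p′⊆q , closed , reach′ = out-closure k′ (⁅ y ⁆ ∪ p) fuel′ reach-p′
    in  q , p′⊆q ∘ p⊆p′ , closed , reach′
    where
    p⊆p′ : p ⊆ ⁅ y ⁆ ∪ p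
    p⊆p′ z∈p = x∈p∪q⁺ (inj₂ z∈p)
    fuel′ : n H < ∣ ⁅ y ⁆ ∪ p ∣ + k′
    fuel′ = <-≤-trans fuel (≤-trans (≤-reflexive (+-suc ∣ p ∣ k′))
              (+-monoˡ-≤ k′ (p⊂q⇒∣p∣<∣q∣ (p⊆p′ , y , x∈p∪q⁺ (inj₁ (x∈⁅x⁆ y)) , y∉p))))
    reach-p′ : ReachableFrom u (⁅ y ⁆ ∪ p)
    reach-p′ z z∈p′ with x∈p∪q⁻ ⁅ y ⁆ p z∈p′
    ... | inj₁ z∈⁅y⁆ with refl ← x∈⁅y⁆⇒x≡y y z∈⁅y⁆ = snoc (reach x x∈p) e
    ... | inj₂ z∈p   = reach z z∈p

  out-closure-of : ∀ u → ∃ λ q → u ∈ q × OutClosed q × ReachableFrom u q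
  out-closure-of u =
    let q , ⁅u⁆⊆q , closed , reach = out-closure (suc (n H)) ⁅ u ⁆ fuel reach-u
    in  q , ⁅u⁆⊆q (x∈⁅x⁆ u) , closed , reach
    where
    fuel : n H < ∣ ⁅ u ⁆ ∣ + suc (n H)
    fuel = <-≤-trans (n<1+n (n H)) (m≤n+m (suc (n H)) _)
    reach-u : ReachableFrom u ⁅ u ⁆
    reach-u x x∈⁅u⁆ with refl ← x∈⁅y⁆⇒x≡y u x∈⁅u⁆ = here

  module _ {P : Pred (V H) 0ℓ} (P? : Decidable P) {a b : V H} (Pa : P a) (¬Pb : ¬ P b) where

    collapse : V H → V H
    collapse x = if does (P? x) then a else b

    collapse-∈ : ∀ {x} → P x → collapse x ≡ a
    collapse-∈ {x} Px rewrite dec-true (P? x) Px = refl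

    collapse-∉ : ∀ {x} → ¬ P x → collapse x ≡ b
    collapse-∉ {x} ¬Px rewrite dec-false (P? x) ¬Px = refl

    collapse-isRetraction : Reflexive H →
      (∀ {x y} → P x → ¬ P y → E H x y → E H a b) →
      (∀ {x y} → ¬ P x → P y → E H x y → E H b a) →
      IsRetraction H collapse
    collapse-isRetraction refl-H leave enter = hom , idem
      where
      hom : IsHom H collapse
      hom x y e with P? x | P? y
      ... | yes Px  | yes Py  = refl-H a
      ... | yes Px  | no ¬Py  = leave Px ¬Py e
      ... | no ¬Px  | yes Py  = enter ¬Px Py e
      ... | no ¬Px  | no ¬Py  = refl-H b
      idem : ∀ x → collapse (collapse x) ≡ collapse x
      idem x with P? x
      ... | yes _ = collapse-∈ Pa
      ... | no _  = collapse-∉ ¬Pb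

    collapse-nontrivial : 3 ≤ n H → RetractTrivial H → ¬ IsRetraction H collapse
    collapse-nontrivial n≥3 rt r with rt collapse r
    ... | inj₁ collapse≗id with w , w≢a , w≢b ← avoid₂ n≥3 a b with P? w | collapse≗id w
    ...   | yes _ | w≡a = w≢a (sym w≡a)
    ...   | no _  | w≡b = w≢b (sym w≡b)
    collapse-nontrivial n≥3 rt r | inj₂ (c , const) = ¬Pb (subst P a≡b Pa)
      where
      a≡b : a ≡ b
      a≡b = trans (sym (collapse-∈ Pa)) (trans (const a) (trans (sym (const b)) (collapse-∉ ¬Pb)))

retractTrivial-op : ∀ H → RetractTrivial H → RetractTrivial (op H)
retractTrivial-op H rt r (hom , idem) = rt r ((λ x y e → hom y x e) , idem)

module RetractTrivialReflexive (H : Digraph) (rt : RetractTrivial H) (refl-H : Reflexive H)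
                               (n≥3 : 3 ≤ n H) where

  no-double-edge : ¬ HasDoubleEdge H
  no-double-edge (u , v , u≢v , uv , vu) =
    collapse-nontrivial H (_≟ v) refl u≢v n≥3 rt
      (collapse-isRetraction H (_≟ v) refl u≢v refl-H (λ _ _ _ → vu) (λ _ _ _ → uv))

  edge-antisym : ∀ {u v} → E H u v → E H v u → u ≡ v
  edge-antisym {u} {v} uv vu = decidable-stable (u ≟ v) λ u≢v → no-double-edge (u , v , u≢v , uv , vu)

  out-closed-collapse-impossible : ∀ {p a b} → OutClosed H p → a ∈ p → b ∉ p →
    (∀ {x y} → x ∉ p → y ∈ p → E H x y → E H b a) → ⊥
  out-closed-collapse-impossible {p} closed a∈p b∉p enter =
    collapse-nontrivial H (_∈? p) a∈p b∉p n≥3 rt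
      (collapse-isRetraction H (_∈? p) a∈p b∉p refl-H (λ x∈p y∉p xy → ⊥-elim (y∉p (closed x∈p xy))) enter)

  -- Collapse onto an edge entering p if there is one, and onto a and b otherwise.
  no-proper-out-closed : ∀ {p a b} → OutClosed H p → a ∈ p → b ∉ p → ⊥
  no-proper-out-closed {p} closed a∈p b∉p
    with any? (λ x → any? (λ y → ¬? (x ∈? p) ×-dec (y ∈? p ×-dec E? H x y)))
  ... | yes (x , y , x∉p , y∈p , xy) = out-closed-collapse-impossible closed y∈p x∉p λ _ _ _ → xy
  ... | no none = out-closed-collapse-impossible closed a∈p b∉p
                    λ x∉p y∈p xy → ⊥-elim (none (_ , _ , x∉p , y∈p , xy))

  strongly-connected : StronglyConnected H
  strongly-connected u v with p , u∈p , closed , reach ← out-closure-of H u with v ∈? p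
  ... | yes v∈p = reach v v∈p
  ... | no v∉p  = ⊥-elim (no-proper-out-closed closed u∈p v∉p)

  endoEdge-id⇒id : ∀ {k} → IsHom H k → EndoEdge H id k → ∀ x → k x ≡ x
  endoEdge-id⇒id {k} k-hom id⟶k x
    with rt (λ y → iterate k y (n H !)) (iterate-isHom H k-hom (n H !) , iterate-!-idempotent k)
  ... | inj₁ e≗id = sym (edge-antisym (id⟶k x x (refl-H x)) kx⟶x)
    where
    kx⟶x : E H (k x) x
    kx⟶x = subst (E H (k x)) (trans (sym (iterate-pred k (1≤n! (n H)))) (e≗id x))
             (iterate-endoEdge-id H id⟶k (pred (n H !)) (k x) (k x) (refl-H (k x)))
  ... | inj₂ (c , e≡c) with w , w≢c , _ ← avoid₂ n≥3 c c =
    ⊥-elim (w≢c (sink-reaches-only-itself H c-sink (strongly-connected c w)))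
    where
    ⟶c : ∀ v → E H v c
    ⟶c v = subst (E H v) (e≡c v) (iterate-endoEdge-id H id⟶k (n H !) v v (refl-H v))
    c-sink : ∀ {v} → E H c v → v ≡ c
    c-sink {v} cv = edge-antisym (⟶c v) cv

automorphism-isolated : ∀ H → RetractTrivial H → Reflexive H → 3 ≤ n H →
                        ∀ f → IsAutomorphism H f → IsolatedInEndoDigraph H f
automorphism-isolated H rt refl-H n≥3 f (_ , h , hf , fh , h-hom) g g-hom f≉g =
  f⟶g-impossible , g⟶f-impossible
  where
  module Op = RetractTrivialReflexive (op H) (retractTrivial-op H rt) refl-H n≥3
  open RetractTrivialReflexive H rt refl-H n≥3
  k-hom : IsHom H (h ∘ g)
  k-hom x y e = h-hom _ _ (g-hom x y e)
  k≗id⇒f≗g : (∀ x → h (g x) ≡ x) → ⊥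
  k≗id⇒f≗g k≗id = f≉g λ x → trans (cong f (sym (k≗id x))) (fh (g x))
  f⟶g-impossible : ¬ EndoEdge H f g
  f⟶g-impossible f⟶g = k≗id⇒f≗g (endoEdge-id⇒id k-hom
    λ x y e → subst (λ z → E H z (h (g y))) (hf x) (h-hom _ _ (f⟶g x y e)))
  g⟶f-impossible : ¬ EndoEdge H g f
  g⟶f-impossible g⟶f = k≗id⇒f≗g (Op.endoEdge-id⇒id (λ x y e → k-hom y x e)
    λ x y e → subst (E H (h (g y))) (hf x) (h-hom _ _ (g⟶f y x e)))

lemma8 : (H : Digraph) → RetractTrivial H → Reflexive H → 3 ≤ n H →
    ¬ HasDoubleEdge H × StronglyConnected H ×
    (∀ f → IsAutomorphism H f → IsolatedInEndoDigraph H f)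
lemma8 H rt refl-H n≥3 =
  no-double-edge , strongly-connected , automorphism-isolated H rt refl-H n≥3
  where open RetractTrivialReflexive H rt refl-H n≥3
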